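{- Let $g\ge 2$ be an integer and let $A\subseteq\mathbb{Z}_q$ be a weak $g$-Sidon set. If $q$ is even, then $|A|\le\sqrt{(g-1)q}+2+\frac{3}{g-1}$. If $q$ is odd, then $|A|\le\sqrt{(g-1)q}+\frac32+\frac{1}{g-1}$.
   Context: For $A\subseteq\mathbb{Z}_q=\mathbb{Z}/q\mathbb{Z}$, the restricted representation function is $r'(x)=\#\{(a_1,a_2): a_1,a_2\in A,\ a_1+a_2=x,\ a_1\ne a_2\}$ (ordered pairs). $A$ is a weak $g$-Sidon set if $r'(x)\le g$ for all $x$. -}

module Defs where

open import Data.Nat using (ℕ; _+_; _≟_; NonZero)
open import Data.Nat.DivMod using (_%_)
open import Data.Fin using (Fin; toℕ)
import Data.Fin.Properties as FinP
open import Data.Fin.Subset using (Subset; _∈_)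
open import Data.Fin.Subset.Properties using (_∈?_)
open import Data.List using (List; length; filter; cartesianProduct; allFin)
open import Data.Product using (_×_; _,_; proj₁; proj₂)
open import Relation.Nullary using (¬_; Dec)
open import Relation.Nullary.Decidable using (_×-dec_; ¬?)
open import Relation.Binary.PropositionalEquality using (_≡_)

_+q_ : {q : ℕ} .{{_ : NonZero q}} → Fin q → Fin q → ℕ
_+q_ {q} a b = (toℕ a + toℕ b) % q

RPair : (q : ℕ) .{{_ : NonZero q}} → Subset q → Fin q → Fin q × Fin q → Set
RPair q A x (a₁ , a₂) = (a₁ ∈ A × a₂ ∈ A) × (¬ (a₁ ≡ a₂) × ((a₁ +q a₂) ≡ toℕ x))

RPair? : (q : ℕ) .{{_ : NonZero q}} → (A : Subset q) → (x : Fin q) →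
         (p : Fin q × Fin q) → Dec (RPair q A x p)
RPair? q A x (a₁ , a₂) =
  ((a₁ ∈? A) ×-dec (a₂ ∈? A)) ×-dec (¬? (a₁ FinP.≟ a₂) ×-dec ((a₁ +q a₂) ≟ toℕ x))

r′ : (q : ℕ) .{{_ : NonZero q}} → Subset q → Fin q → ℕ
r′ q A x = length (filter (RPair? q A x) (cartesianProduct (allFin q) (allFin q)))

WeakSidon : (q : ℕ) .{{_ : NonZero q}} → ℕ → Subset q → Set
WeakSidon q g A = ∀ (x : Fin q) → r′ q A x Data.Nat.≤ g

{-# OPTIONS --safe #-}
-- Let k = |A| and D(d) = #{c ∈ A : c + d ∈ A}, so that ∑ D = k² and D(0) = k. The energy ∑ D(d)² equals
-- ∑_{a,b ∈ A} r(a + b), where r counts ordered representations; r(x) ≤ r′(x) + s(x) with s(x) the number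
-- of c ∈ A with 2c = x, and ∑_{a,b ∈ A} s(a + b) = ∑_{c ∈ A} r(2c), where s(2c) is at most the number τ
-- of elements of order at most 2. Hence ∑ D² ≤ g k² + (g + τ) k, and Cauchy–Schwarz over the nonzero
-- differences gives (k² − k)² ≤ q ((g − 1) k² + (g + τ) k). In ℤ_q, τ ≤ 2, and τ = 1 when q is odd;
-- the two bounds are this quartic inequality solved for k.
module Submission where

open import Defs
open import Data.Nat using (ℕ; suc; _+_; _*_; _∸_; _^_; _≤_; NonZero)
open import Data.Nat.Divisibility using (_∣_)
open import Data.Fin.Subset using (Subset; ∣_∣)
open import Data.Product using (_×_)
open import Relation.Nullary using (¬_)

open import Algebra.Bundles using (AbelianGroup)
open import Algebra.Consequences.Propositional using (comm∧idʳ⇒id; comm∧invʳ⇒inv)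
open import Algebra.Core using (Op₁; Op₂)
open import Algebra.Structures using (IsAbelianGroup)
open import Data.Bool.Base using (true; false; if_then_else_)
open import Data.Fin.Base using (Fin; zero; suc; toℕ; fromℕ<)
open import Data.Fin.Permutation using (permutation)
open import Data.Fin.Properties using (_≟_; toℕ-injective; toℕ-fromℕ<; toℕ<n)
open import Data.Fin.Subset using (inside; outside)
open import Data.Fin.Subset.Properties using (_∈?_)
open import Data.List.Base using (List; []; _∷_; _++_; map; length; filter; tabulate; cartesianProduct)
open import Data.List.Properties using (filter-++; length-++; map-tabulate)
open import Data.Nat.Base
open import Data.Nat.DivMod using (_%_; _mod_; %-distribˡ-+; m%n%n≡m%n; m<n⇒m%n≡m; n%n≡0)
open import Data.Nat.Divisibility using (divides; m%n≡0⇒n∣m)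
open import Data.Nat.Properties hiding (_≟_)
import Data.Nat.Properties as ℕₚ
open import Data.Nat.Tactic.RingSolver using (solve; solve-∀)
open import Data.Product.Base using (_,_)
open import Data.Sum.Base using (_⊎_; inj₁; inj₂)
import Data.Vec.Base as Vec
open import Data.Vec.Functional using (removeAt)
open import Function.Base using (id; _∘_)
open import Level using (Level)
open import Relation.Binary.PropositionalEquality
open import Relation.Nullary.Decidable using (Dec; does; yes; no; _×-dec_; ¬?)
open import Relation.Nullary.Negation using (contradiction)
open import Relation.Unary using (Pred; Decidable)
open import Algebra.Properties.Semiring.Sum +-*-semiring
  using (sum; sum-syntax; sum-cong-≗; ∑-distrib-+; ∑-comm; ∑-permute; sum-remove; *-distribˡ-sum; *-distribʳ-sum)

private variable
  a ℓ ℓ₁ ℓ₂ ℓ₃ : Level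
  A : Set a
  P : Set ℓ₁
  Q : Set ℓ₂
  R : Set ℓ₃

𝟙 : Dec P → ℕ
𝟙 d = if does d then 1 else 0

𝟙-≤-1 : (p? : Dec P) → 𝟙 p? ≤ 1
𝟙-≤-1 (yes _) = ≤-refl
𝟙-≤-1 (no _)  = z≤n

𝟙-idem : (p? : Dec P) → 𝟙 p? * 𝟙 p? ≡ 𝟙 p?
𝟙-idem (yes _) = refl
𝟙-idem (no _)  = refl

𝟙-× : (p? : Dec P) (q? : Dec Q) → 𝟙 (p? ×-dec q?) ≡ 𝟙 p? * 𝟙 q?
𝟙-× (yes _) (yes _) = refl
𝟙-× (yes _) (no _)  = refl
𝟙-× (no _)  _       = refl

𝟙-mono : (P → Q) → (p? : Dec P) (q? : Dec Q) → 𝟙 p? ≤ 𝟙 q?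
𝟙-mono _   (yes _) (yes _) = ≤-refl
𝟙-mono P⇒Q (yes p) (no ¬q) = contradiction (P⇒Q p) ¬q
𝟙-mono _   (no _)  _       = z≤n

𝟙-cong : (P → Q) → (Q → P) → (p? : Dec P) (q? : Dec Q) → 𝟙 p? ≡ 𝟙 q?
𝟙-cong P⇒Q Q⇒P p? q? = ≤-antisym (𝟙-mono P⇒Q p? q?) (𝟙-mono Q⇒P q? p?)

𝟙-mono-⊎ : (P → Q ⊎ R) → (p? : Dec P) (q? : Dec Q) (r? : Dec R) → 𝟙 p? ≤ 𝟙 q? + 𝟙 r?
𝟙-mono-⊎ _      (no _)  _       _       = z≤n
𝟙-mono-⊎ _      (yes _) (yes _) _       = s≤s z≤n
𝟙-mono-⊎ P⇒Q⊎R (yes p) (no ¬q) r? with P⇒Q⊎R p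
... | inj₁ q = contradiction q ¬q
... | inj₂ r = 𝟙-mono (λ _ → r) (yes p) r?

≤-*𝟙¬+𝟙 : ∀ {m} (p? : Dec P) → m ≤ 1 → m ≤ m * 𝟙 (¬? p?) + 𝟙 p?
≤-*𝟙¬+𝟙 {m = m} (yes _) m≤1 = subst (m ≤_) (sym (cong (_+ 1) (*-zeroʳ m))) m≤1
≤-*𝟙¬+𝟙 {m = m} (no _)  _   = ≤-reflexive (sym (trans (+-identityʳ (m * 1)) (*-identityʳ m)))

∑-mono-≤ : ∀ {n} {f g : Fin n → ℕ} → (∀ i → f i ≤ g i) → sum f ≤ sum g
∑-mono-≤ {zero}  f≤g = z≤n
∑-mono-≤ {suc n} f≤g = +-mono-≤ (f≤g zero) (∑-mono-≤ (f≤g ∘ suc))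

∑-select : ∀ {n} (f : Fin n → ℕ) y → ∑[ i < n ] (f i * 𝟙 (i ≟ y)) ≡ f y
∑-select {suc n} f zero    =
  trans (cong₂ _+_ (*-identityʳ (f zero)) ∑-*-zero) (+-identityʳ (f zero))
  where
  ∑-*-zero : ∑[ i < n ] (f (suc i) * 0) ≡ 0
  ∑-*-zero = trans (sym (*-distribʳ-sum 0 (f ∘ suc))) (*-zeroʳ (sum (f ∘ suc)))
∑-select {suc n} f (suc y) =
  trans (cong (_+ ∑[ i < n ] (f (suc i) * 𝟙 (i ≟ y))) (*-zeroʳ (f zero))) (∑-select (f ∘ suc) y)

∑-𝟙-≟ : ∀ {n} (y : Fin n) → ∑[ i < n ] 𝟙 (i ≟ y) ≡ 1
∑-𝟙-≟ y = trans (sum-cong-≗ (λ i → sym (*-identityˡ (𝟙 (i ≟ y))))) (∑-select (λ _ → 1) y)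

∑-*-∑ : ∀ {m n} (f : Fin m → ℕ) (g : Fin n → ℕ) → sum f * sum g ≡ ∑[ i < m ] ∑[ j < n ] (f i * g j)
∑-*-∑ f g = trans (*-distribʳ-sum (sum g) f) (sum-cong-≗ (λ i → *-distribˡ-sum (f i) g))

∣p∣≡∑𝟙∈ : ∀ {n} (p : Subset n) → ∣ p ∣ ≡ ∑[ i < n ] 𝟙 (i ∈? p)
∣p∣≡∑𝟙∈ Vec.[]            = refl
∣p∣≡∑𝟙∈ (inside Vec.∷ p)  = cong suc (∣p∣≡∑𝟙∈ p)
∣p∣≡∑𝟙∈ (outside Vec.∷ p) = ∣p∣≡∑𝟙∈ p

module _ {P : Pred A ℓ} (P? : Decidable P) where

  length-filter-tabulate : ∀ {n} (f : Fin n → A) → length (filter P? (tabulate f)) ≡ ∑[ i < n ] 𝟙 (P? (f i))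
  length-filter-tabulate {zero}  f = refl
  length-filter-tabulate {suc n} f with does (P? (f zero))
  ... | true  = cong suc (length-filter-tabulate (f ∘ suc))
  ... | false = length-filter-tabulate (f ∘ suc)

  length-filter-++ : ∀ (xs ys : List A) → length (filter P? (xs ++ ys)) ≡ length (filter P? xs) + length (filter P? ys)
  length-filter-++ xs ys = trans (cong length (filter-++ P? xs ys)) (length-++ (filter P? xs))

length-filter-cartesianProduct : ∀ {m n} {B : Set a} {P : Pred (A × B) ℓ} (P? : Decidable P)
  (f : Fin m → A) (g : Fin n → B) →
  length (filter P? (cartesianProduct (tabulate f) (tabulate g))) ≡ ∑[ i < m ] ∑[ j < n ] 𝟙 (P? (f i , g j))
length-filter-cartesianProduct {m = zero}  P? f g = refl
length-filter-cartesianProduct {m = suc m} P? f g = begin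
  length (filter P? (map (f zero ,_) (tabulate g) ++ cartesianProduct (tabulate (f ∘ suc)) (tabulate g)))
    ≡⟨ length-filter-++ P? (map (f zero ,_) (tabulate g)) _ ⟩
  length (filter P? (map (f zero ,_) (tabulate g))) + length (filter P? (cartesianProduct (tabulate (f ∘ suc)) (tabulate g)))
    ≡⟨ cong₂ _+_ (trans (cong (length ∘ filter P?) (map-tabulate g (f zero ,_))) (length-filter-tabulate P? (λ j → f zero , g j)))
                 (length-filter-cartesianProduct P? (f ∘ suc) g) ⟩
  ∑[ i < suc m ] ∑[ j < _ ] 𝟙 (P? (f i , g j)) ∎
  where open ≡-Reasoning

2xy≤x²+y² : ∀ x y → 2 * (x * y) ≤ x * x + y * y
2xy≤x²+y² x y with ≤-total x y
... | inj₁ x≤y with t , refl ← m≤n⇒∃[o]m+o≡n x≤y = begin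
  2 * (x * (x + t))                 ≤⟨ m≤m+n _ (t * t) ⟩
  2 * (x * (x + t)) + t * t         ≡⟨ solve (x ∷ t ∷ []) ⟩
  x * x + (x + t) * (x + t)         ∎
  where open ≤-Reasoning
... | inj₂ y≤x with t , refl ← m≤n⇒∃[o]m+o≡n y≤x = begin
  2 * ((y + t) * y)                 ≤⟨ m≤m+n _ (t * t) ⟩
  2 * ((y + t) * y) + t * t         ≡⟨ solve (y ∷ t ∷ []) ⟩
  (y + t) * (y + t) + y * y         ∎
  where open ≤-Reasoning

cross-term-≤ : ∀ m x s Q → s * s ≤ m * Q → 2 * (x * s) ≤ Q + m * (x * x)
cross-term-≤ zero    x zero    Q _  = subst (_≤ Q + 0) (sym (cong (2 *_) (*-zeroʳ x))) z≤n
cross-term-≤ (suc m) x s Q s²≤mQ = *-cancelˡ-≤ (suc m) (begin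
  suc m * (2 * (x * s))                   ≡⟨ solve (m ∷ x ∷ s ∷ []) ⟩
  2 * (s * (suc m * x))                   ≤⟨ 2xy≤x²+y² s (suc m * x) ⟩
  s * s + suc m * x * (suc m * x)         ≤⟨ +-monoˡ-≤ _ s²≤mQ ⟩
  suc m * Q + suc m * x * (suc m * x)     ≡⟨ solve (m ∷ x ∷ Q ∷ []) ⟩
  suc m * (Q + suc m * (x * x))           ∎)
  where open ≤-Reasoning

cauchy-schwarz : ∀ {n} (f : Fin n → ℕ) → sum f * sum f ≤ n * ∑[ i < n ] (f i * f i)
cauchy-schwarz {zero}  f = z≤n
cauchy-schwarz {suc n} f = begin
  (x + s) * (x + s)                  ≡⟨ expand x s ⟩
  x * x + 2 * (x * s) + s * s        ≤⟨ +-mono-≤ (+-monoʳ-≤ (x * x) (cross-term-≤ n x s q ih)) ih ⟩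
  x * x + (q + n * (x * x)) + n * q  ≡⟨ collect x q n ⟩
  suc n * (x * x + q)                ∎
  where
  open ≤-Reasoning
  x s q : ℕ
  x = f zero
  s = sum (f ∘ suc)
  q = ∑[ i < n ] (f (suc i) * f (suc i))
  ih : s * s ≤ n * q
  ih = cauchy-schwarz (f ∘ suc)
  expand : ∀ x s → (x + s) * (x + s) ≡ x * x + 2 * (x * s) + s * s
  expand = solve-∀
  collect : ∀ x q n → x * x + (q + n * (x * x)) + n * q ≡ suc n * (x * x + q)
  collect = solve-∀

square-≤-of-cubic : ∀ m a b H → (m + a) * (m + b) * (m + b) ≤ H * (m + (a + 2 * b)) → m * m ≤ H
square-≤-of-cubic zero    a b H _     = z≤n
square-≤-of-cubic (suc m) a b H cubic = *-cancelʳ-≤ (suc m * suc m) H (suc m + (a + 2 * b)) (begin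
  suc m * suc m * (suc m + (a + 2 * b))                               ≤⟨ m≤m+n _ _ ⟩
  suc m * suc m * (suc m + (a + 2 * b)) + (suc m * b * b + 2 * suc m * a * b + a * b * b) ≡⟨ solve (m ∷ a ∷ b ∷ []) ⟩
  (suc m + a) * (suc m + b) * (suc m + b)                             ≤⟨ cubic ⟩
  H * (suc m + (a + 2 * b))                                           ∎)
  where open ≤-Reasoning

monus-square-≤ : ∀ Y d b H → (Y + d) * Y * Y ≤ H * (Y + d + 2 * b) → (Y ∸ b) ^ 2 ≤ H
monus-square-≤ Y d b H cubic with b ≤? Y
... | no b≰Y rewrite m≤n⇒m∸n≡0 (<⇒≤ (≰⇒> b≰Y)) = z≤n
... | yes b≤Y with m , refl ← m≤n⇒∃[o]m+o≡n b≤Y rewrite m+n∸m≡n b m | *-identityʳ m =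
  square-≤-of-cubic m (d + b) b H (subst₂ _≤_ (regroupˡ b m d) (cong (H *_) (regroupʳ b m d)) cubic)
  where
  regroupˡ : ∀ b m d → (b + m + d) * (b + m) * (b + m) ≡ (m + (d + b)) * (m + b) * (m + b)
  regroupˡ = solve-∀
  regroupʳ : ∀ b m d → b + m + d + 2 * b ≡ m + (d + b + 2 * b)
  regroupʳ = solve-∀

-- Multiplied by h³ and divided by K, the hypothesis reads (Y + h) Y² ≤ h³ n (Y + h + (h + 3)) for
-- Y = h (K − 1). The ring solver treats _^_ as opaque, hence h ^ 3 written out as h * (h * (h * 1)).
even-bound : ∀ h n K → K * (K ∸ 1) * (K * (K ∸ 1)) ≤ n * (h * (K * K) + (h + 3) * K) →
             (h * K ∸ (2 * h + 3)) ^ 2 ≤ h ^ 3 * n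
even-bound h n zero    _ rewrite *-zeroʳ h | 0∸n≡0 (2 * h + 3) = z≤n
even-bound h n (suc k) quartic = subst (λ x → x ^ 2 ≤ h ^ 3 * n) (sym shift)
  (monus-square-≤ (h * k) h (h + 3) (h ^ 3 * n) (*-cancelˡ-≤ (suc k) (begin
    suc k * ((h * k + h) * (h * k) * (h * k))                  ≡⟨ solve (h ∷ k ∷ []) ⟩
    h * (h * (h * 1)) * (suc k * k * (suc k * k))              ≤⟨ *-monoʳ-≤ (h ^ 3) quartic ⟩
    h * (h * (h * 1)) * (n * (h * (suc k * suc k) + (h + 3) * suc k))   ≡⟨ solve (h ∷ k ∷ n ∷ []) ⟩
    suc k * (h * (h * (h * 1)) * n * (h * k + h + (h + 3)))    ≤⟨ *-monoʳ-≤ (suc k) (*-monoʳ-≤ (h ^ 3 * n)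
                                                                    (+-monoʳ-≤ (h * k + h) (m≤m+n (h + 3) _))) ⟩
    suc k * (h * (h * (h * 1)) * n * (h * k + h + 2 * (h + 3))) ∎)))
  where
  open ≤-Reasoning
  shift : h * suc k ∸ (2 * h + 3) ≡ h * k ∸ (h + 3)
  shift = trans (cong₂ _∸_ (*-suc h k) (split h)) ([m+n]∸[m+o]≡n∸o h (h * k) (h + 3))
    where
    split : ∀ h → 2 * h + 3 ≡ h + (h + 3)
    split = solve-∀

odd-bound : ∀ h n K → K * (K ∸ 1) * (K * (K ∸ 1)) ≤ n * (h * (K * K) + (h + 2) * K) →
            (2 * h * K ∸ (3 * h + 2)) ^ 2 ≤ 4 * h ^ 3 * n
odd-bound h n zero    _ rewrite *-zeroʳ (2 * h) | 0∸n≡0 (3 * h + 2) = z≤n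
odd-bound h n (suc k) quartic = subst (λ x → x ^ 2 ≤ 4 * h ^ 3 * n) (sym shift)
  (monus-square-≤ (2 * h * k) (2 * h) (h + 2) (4 * h ^ 3 * n) (*-cancelˡ-≤ (suc k) (begin
    suc k * ((2 * h * k + 2 * h) * (2 * h * k) * (2 * h * k))          ≡⟨ solve (h ∷ k ∷ []) ⟩
    8 * (h * (h * (h * 1))) * (suc k * k * (suc k * k))                ≤⟨ *-monoʳ-≤ (8 * h ^ 3) quartic ⟩
    8 * (h * (h * (h * 1))) * (n * (h * (suc k * suc k) + (h + 2) * suc k)) ≡⟨ solve (h ∷ k ∷ n ∷ []) ⟩
    suc k * (4 * (h * (h * (h * 1))) * n * (2 * h * k + 2 * h + 2 * (h + 2))) ∎)))
  where
  open ≤-Reasoning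
  shift : 2 * h * suc k ∸ (3 * h + 2) ≡ 2 * h * k ∸ (h + 2)
  shift = trans (cong₂ _∸_ (*-suc (2 * h) k) (split h)) ([m+n]∸[m+o]≡n∸o (2 * h) (2 * h * k) (h + 2))
    where
    split : ∀ h → 3 * h + 2 ≡ 2 * h + (h + 2)
    split = solve-∀

module AdditiveEnergy {p : ℕ} {op : Op₂ (Fin (suc p))} {ε : Fin (suc p)} {inv : Op₁ (Fin (suc p))}
  (isAbelianGroup : IsAbelianGroup _≡_ op ε inv) (A : Subset (suc p)) where

  private
    n : ℕ
    n = suc p
    -- The operations are used through this bundle, which supplies their fixities.
    G : AbelianGroup _ _
    G = record { isAbelianGroup = isAbelianGroup }

  open AbelianGroup G using (_∙_; _⁻¹; comm; identityʳ)
  open import Algebra.Properties.AbelianGroup G using (\\-leftDividesˡ; \\-leftDividesʳ; y≈x\\z; identityʳ-unique)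
  open import Algebra.Properties.CommutativeSemigroup (AbelianGroup.commutativeSemigroup G) using (interchange; x∙yz≈y∙xz)

  χ : Fin n → ℕ
  χ a = 𝟙 (a ∈? A)

  k : ℕ
  k = sum χ

  diffs : Fin n → ℕ
  diffs d = ∑[ c < n ] (χ c * χ (c ∙ d))

  energy : ℕ
  energy = ∑[ d < n ] (diffs d * diffs d)

  reps : Fin n → ℕ
  reps x = ∑[ c < n ] (χ c * χ (c ⁻¹ ∙ x))

  reps≠ : Fin n → ℕ
  reps≠ x = ∑[ a < n ] ∑[ b < n ] ((χ a * χ b) * (𝟙 (¬? (a ≟ b)) * 𝟙 (a ∙ b ≟ x)))

  halves : Fin n → ℕ
  halves x = ∑[ c < n ] (χ c * 𝟙 (x ≟ c ∙ c))

  torsion₂ : ℕ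
  torsion₂ = ∑[ t < n ] 𝟙 (t ∙ t ≟ ε)

  ∑-translate : ∀ c (f : Fin n → ℕ) → ∑[ d < n ] f (c ∙ d) ≡ sum f
  ∑-translate c f = sym (∑-permute f (permutation (c ∙_) (c ⁻¹ ∙_) (\\-leftDividesˡ c) (\\-leftDividesʳ c)))

  ∑-select∙ : ∀ (f : Fin n → ℕ) a y → ∑[ b < n ] (f b * 𝟙 (a ∙ b ≟ y)) ≡ f (a ⁻¹ ∙ y)
  ∑-select∙ f a y = trans (sum-cong-≗ (λ b → cong (f b *_) (𝟙-cong (y≈x\\z a b y) solved (a ∙ b ≟ y) (b ≟ a ⁻¹ ∙ y))))
                          (∑-select f (a ⁻¹ ∙ y))
    where
    solved : ∀ {b} → b ≡ a ⁻¹ ∙ y → a ∙ b ≡ y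
    solved refl = \\-leftDividesˡ a y

  χ-idem : ∀ a → χ a * χ a ≡ χ a
  χ-idem a = 𝟙-idem (a ∈? A)

  χ≤1 : ∀ a → χ a ≤ 1
  χ≤1 a = 𝟙-≤-1 (a ∈? A)

  ∑-diffs : sum diffs ≡ k * k
  ∑-diffs = begin
    ∑[ d < n ] ∑[ c < n ] (χ c * χ (c ∙ d))  ≡⟨ ∑-comm (λ d c → χ c * χ (c ∙ d)) ⟩
    ∑[ c < n ] ∑[ d < n ] (χ c * χ (c ∙ d))  ≡⟨ sum-cong-≗ (λ c → trans (sym (*-distribˡ-sum (χ c) (χ ∘ (c ∙_))))
                                                                      (cong (χ c *_) (∑-translate c χ))) ⟩
    ∑[ c < n ] (χ c * k)                     ≡⟨ sym (*-distribʳ-sum k χ) ⟩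
    k * k                                    ∎
    where open ≡-Reasoning

  diffs-ε : diffs ε ≡ k
  diffs-ε = sum-cong-≗ (λ c → trans (cong (λ x → χ c * χ x) (identityʳ c)) (χ-idem c))

  -- Both sides count the solutions of a ∙ b = c ∙ e in A⁴.
  energy≡∑reps : energy ≡ ∑[ a < n ] ∑[ b < n ] (χ a * χ b * reps (a ∙ b))
  energy≡∑reps = begin
    ∑[ d < n ] (diffs d * diffs d)
      ≡⟨ sum-cong-≗ (λ d → *-distribʳ-sum (diffs d) (λ c → χ c * χ (c ∙ d))) ⟩
    ∑[ d < n ] ∑[ c < n ] (χ c * χ (c ∙ d) * diffs d)
      ≡⟨ ∑-comm (λ d c → χ c * χ (c ∙ d) * diffs d) ⟩
    ∑[ c < n ] ∑[ d < n ] (χ c * χ (c ∙ d) * diffs d)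
      ≡⟨ sum-cong-≗ (λ c → sym (∑-translate (c ⁻¹) (λ d → χ c * χ (c ∙ d) * diffs d))) ⟩
    ∑[ c < n ] ∑[ a < n ] (χ c * χ (c ∙ (c ⁻¹ ∙ a)) * diffs (c ⁻¹ ∙ a))
      ≡⟨ sum-cong-≗ (λ c → sum-cong-≗ (λ a → trans (cong (λ x → χ c * χ x * diffs (c ⁻¹ ∙ a)) (\\-leftDividesˡ c a))
                                                     (*-distribˡ-sum (χ c * χ a) (λ b → χ b * χ (b ∙ (c ⁻¹ ∙ a)))))) ⟩
    ∑[ c < n ] ∑[ a < n ] ∑[ b < n ] (χ c * χ a * (χ b * χ (b ∙ (c ⁻¹ ∙ a))))
      ≡⟨ ∑-comm (λ c a → ∑[ b < n ] (χ c * χ a * (χ b * χ (b ∙ (c ⁻¹ ∙ a))))) ⟩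
    ∑[ a < n ] ∑[ c < n ] ∑[ b < n ] (χ c * χ a * (χ b * χ (b ∙ (c ⁻¹ ∙ a))))
      ≡⟨ sum-cong-≗ (λ a → ∑-comm (λ c b → χ c * χ a * (χ b * χ (b ∙ (c ⁻¹ ∙ a))))) ⟩
    ∑[ a < n ] ∑[ b < n ] ∑[ c < n ] (χ c * χ a * (χ b * χ (b ∙ (c ⁻¹ ∙ a))))
      ≡⟨ sum-cong-≗ (λ a → sum-cong-≗ (λ b → sum-cong-≗ (λ c →
           trans (cong (λ x → χ c * χ a * (χ b * χ x)) (swap a b c)) (rearrange (χ c) (χ a) (χ b) _)))) ⟩
    ∑[ a < n ] ∑[ b < n ] ∑[ c < n ] (χ a * χ b * (χ c * χ (c ⁻¹ ∙ (a ∙ b))))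
      ≡⟨ sum-cong-≗ (λ a → sum-cong-≗ (λ b → sym (*-distribˡ-sum (χ a * χ b) (λ c → χ c * χ (c ⁻¹ ∙ (a ∙ b)))))) ⟩
    ∑[ a < n ] ∑[ b < n ] (χ a * χ b * reps (a ∙ b))
      ∎
    where
    open ≡-Reasoning
    swap : ∀ a b c → b ∙ (c ⁻¹ ∙ a) ≡ c ⁻¹ ∙ (a ∙ b)
    swap a b c = trans (x∙yz≈y∙xz b (c ⁻¹) a) (cong (c ⁻¹ ∙_) (comm b a))
    rearrange : ∀ w x y z → w * x * (y * z) ≡ x * y * (w * z)
    rearrange = solve-∀

  reps≤reps≠+halves : ∀ x → reps x ≤ reps≠ x + halves x
  reps≤reps≠+halves x = begin
    ∑[ a < n ] (χ a * χ (a ⁻¹ ∙ x))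
      ≤⟨ ∑-mono-≤ (λ a → *-monoʳ-≤ (χ a) (≤-*𝟙¬+𝟙 (a ≟ a ⁻¹ ∙ x) (χ≤1 (a ⁻¹ ∙ x)))) ⟩
    ∑[ a < n ] (χ a * (χ (a ⁻¹ ∙ x) * 𝟙 (¬? (a ≟ a ⁻¹ ∙ x)) + 𝟙 (a ≟ a ⁻¹ ∙ x)))
      ≡⟨ sum-cong-≗ (λ a → trans (*-distribˡ-+ (χ a) _ _)
                                 (cong₂ _+_ (trans (sym (*-assoc (χ a) _ _)) (sym (distinct-reps a)))
                                            (cong (χ a *_) (𝟙-cong (sym ∘ solves a) (halves-solve a) (a ≟ a ⁻¹ ∙ x) (x ≟ a ∙ a))))) ⟩
    ∑[ a < n ] (∑[ b < n ] ((χ a * χ b) * (𝟙 (¬? (a ≟ b)) * 𝟙 (a ∙ b ≟ x))) + χ a * 𝟙 (x ≟ a ∙ a))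
      ≡⟨ ∑-distrib-+ (λ a → ∑[ b < n ] ((χ a * χ b) * (𝟙 (¬? (a ≟ b)) * 𝟙 (a ∙ b ≟ x)))) (λ a → χ a * 𝟙 (x ≟ a ∙ a)) ⟩
    reps≠ x + halves x
      ∎
    where
    open ≤-Reasoning
    solves : ∀ a → a ≡ a ⁻¹ ∙ x → a ∙ a ≡ x
    solves a a≡ = trans (cong (a ∙_) a≡) (\\-leftDividesˡ a x)
    halves-solve : ∀ a → x ≡ a ∙ a → a ≡ a ⁻¹ ∙ x
    halves-solve a x≡ = y≈x\\z a a x (sym x≡)
    distinct-reps : ∀ a → ∑[ b < n ] ((χ a * χ b) * (𝟙 (¬? (a ≟ b)) * 𝟙 (a ∙ b ≟ x)))
                          ≡ χ a * χ (a ⁻¹ ∙ x) * 𝟙 (¬? (a ≟ a ⁻¹ ∙ x))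
    distinct-reps a = trans (sum-cong-≗ (λ b → sym (*-assoc (χ a * χ b) (𝟙 (¬? (a ≟ b))) (𝟙 (a ∙ b ≟ x)))))
                            (∑-select∙ (λ b → χ a * χ b * 𝟙 (¬? (a ≟ b))) a x)

  ∑-halves : ∑[ a < n ] ∑[ b < n ] (χ a * χ b * halves (a ∙ b)) ≡ ∑[ c < n ] (χ c * reps (c ∙ c))
  ∑-halves = begin
    ∑[ a < n ] ∑[ b < n ] (χ a * χ b * halves (a ∙ b))
      ≡⟨ sum-cong-≗ (λ a → sum-cong-≗ (λ b → *-distribˡ-sum (χ a * χ b) (λ c → χ c * 𝟙 (a ∙ b ≟ c ∙ c)))) ⟩
    ∑[ a < n ] ∑[ b < n ] ∑[ c < n ] (χ a * χ b * (χ c * 𝟙 (a ∙ b ≟ c ∙ c)))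
      ≡⟨ sum-cong-≗ (λ a → ∑-comm (λ b c → χ a * χ b * (χ c * 𝟙 (a ∙ b ≟ c ∙ c)))) ⟩
    ∑[ a < n ] ∑[ c < n ] ∑[ b < n ] (χ a * χ b * (χ c * 𝟙 (a ∙ b ≟ c ∙ c)))
      ≡⟨ ∑-comm (λ a c → ∑[ b < n ] (χ a * χ b * (χ c * 𝟙 (a ∙ b ≟ c ∙ c)))) ⟩
    ∑[ c < n ] ∑[ a < n ] ∑[ b < n ] (χ a * χ b * (χ c * 𝟙 (a ∙ b ≟ c ∙ c)))
      ≡⟨ sum-cong-≗ (λ c → sum-cong-≗ (λ a → trans (sum-cong-≗ (λ b → rearrange (χ a) (χ b) (χ c) (𝟙 (a ∙ b ≟ c ∙ c))))
           (trans (sym (*-distribˡ-sum (χ c * χ a) (λ b → χ b * 𝟙 (a ∙ b ≟ c ∙ c))))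
                  (cong (χ c * χ a *_) (∑-select∙ χ a (c ∙ c)))))) ⟩
    ∑[ c < n ] ∑[ a < n ] (χ c * χ a * χ (a ⁻¹ ∙ (c ∙ c)))
      ≡⟨ sum-cong-≗ (λ c → trans (sum-cong-≗ (λ a → *-assoc (χ c) (χ a) (χ (a ⁻¹ ∙ (c ∙ c)))))
                                 (sym (*-distribˡ-sum (χ c) (λ a → χ a * χ (a ⁻¹ ∙ (c ∙ c)))))) ⟩
    ∑[ c < n ] (χ c * reps (c ∙ c))
      ∎
    where
    open ≡-Reasoning
    rearrange : ∀ x y z w → x * y * (z * w) ≡ z * x * (y * w)
    rearrange = solve-∀

  halves-double≤torsion₂ : ∀ c → halves (c ∙ c) ≤ torsion₂
  halves-double≤torsion₂ c = begin
    ∑[ a < n ] (χ a * 𝟙 (c ∙ c ≟ a ∙ a))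
      ≤⟨ ∑-mono-≤ (λ a → ≤-trans (*-monoˡ-≤ (𝟙 (c ∙ c ≟ a ∙ a)) (χ≤1 a)) (≤-reflexive (*-identityˡ (𝟙 (c ∙ c ≟ a ∙ a))))) ⟩
    ∑[ a < n ] 𝟙 (c ∙ c ≟ a ∙ a)
      ≡⟨ sym (∑-translate c (λ a → 𝟙 (c ∙ c ≟ a ∙ a))) ⟩
    ∑[ t < n ] 𝟙 (c ∙ c ≟ (c ∙ t) ∙ (c ∙ t))
      ≤⟨ ∑-mono-≤ (λ t → 𝟙-mono (torsion t) (c ∙ c ≟ (c ∙ t) ∙ (c ∙ t)) (t ∙ t ≟ ε)) ⟩
    torsion₂
      ∎
    where
    open ≤-Reasoning
    torsion : ∀ t → c ∙ c ≡ (c ∙ t) ∙ (c ∙ t) → t ∙ t ≡ ε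
    torsion t eq = identityʳ-unique (c ∙ c) (t ∙ t) (sym (trans eq (interchange c t c t)))

  energy-≤ : ∀ g → (∀ x → reps≠ x ≤ g) → energy ≤ g * (k * k) + (g + torsion₂) * k
  energy-≤ g sidon = begin
    energy
      ≡⟨ energy≡∑reps ⟩
    ∑[ a < n ] ∑[ b < n ] (χ a * χ b * reps (a ∙ b))
      ≤⟨ ∑-mono-≤ (λ a → ∑-mono-≤ (λ b → ≤-trans (*-monoʳ-≤ (χ a * χ b) (reps≤g+halves (a ∙ b)))
                                                 (≤-reflexive (*-distribˡ-+ (χ a * χ b) g (halves (a ∙ b)))))) ⟩
    ∑[ a < n ] ∑[ b < n ] (χ a * χ b * g + χ a * χ b * halves (a ∙ b))
      ≡⟨ trans (sum-cong-≗ (λ a → ∑-distrib-+ (λ b → χ a * χ b * g) (λ b → χ a * χ b * halves (a ∙ b))))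
               (∑-distrib-+ (λ a → ∑[ b < n ] (χ a * χ b * g)) (λ a → ∑[ b < n ] (χ a * χ b * halves (a ∙ b)))) ⟩
    ∑[ a < n ] ∑[ b < n ] (χ a * χ b * g) + ∑[ a < n ] ∑[ b < n ] (χ a * χ b * halves (a ∙ b))
      ≡⟨ cong₂ _+_ ∑∑χχg ∑-halves ⟩
    g * (k * k) + ∑[ c < n ] (χ c * reps (c ∙ c))
      ≤⟨ +-monoʳ-≤ (g * (k * k)) (∑-mono-≤ (λ c → *-monoʳ-≤ (χ c)
           (≤-trans (reps≤g+halves (c ∙ c)) (+-monoʳ-≤ g (halves-double≤torsion₂ c))))) ⟩
    g * (k * k) + ∑[ c < n ] (χ c * (g + torsion₂))
      ≡⟨ cong (g * (k * k) +_) (sym (*-distribʳ-sum (g + torsion₂) χ)) ⟩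
    g * (k * k) + k * (g + torsion₂)
      ≡⟨ cong (g * (k * k) +_) (*-comm k (g + torsion₂)) ⟩
    g * (k * k) + (g + torsion₂) * k
      ∎
    where
    open ≤-Reasoning
    reps≤g+halves : ∀ x → reps x ≤ g + halves x
    reps≤g+halves x = ≤-trans (reps≤reps≠+halves x) (+-monoˡ-≤ (halves x) (sidon x))
    ∑∑χχg : ∑[ a < n ] ∑[ b < n ] (χ a * χ b * g) ≡ g * (k * k)
    ∑∑χχg = begin-equality
      ∑[ a < n ] ∑[ b < n ] (χ a * χ b * g)    ≡⟨ sum-cong-≗ (λ a → sym (*-distribʳ-sum g (λ b → χ a * χ b))) ⟩
      ∑[ a < n ] (∑[ b < n ] (χ a * χ b) * g)  ≡⟨ sym (*-distribʳ-sum g (λ a → ∑[ b < n ] (χ a * χ b))) ⟩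
      ∑[ a < n ] ∑[ b < n ] (χ a * χ b) * g    ≡⟨ cong (_* g) (sym (∑-*-∑ χ χ)) ⟩
      k * k * g                                ≡⟨ *-comm (k * k) g ⟩
      g * (k * k)                              ∎

  quartic-bound : ∀ h w → (∀ x → reps≠ x ≤ suc h) → torsion₂ ≤ w →
                  k * (k ∸ 1) * (k * (k ∸ 1)) ≤ n * (h * (k * k) + (h + suc w) * k)
  quartic-bound h w sidon τ≤w = begin
    k * (k ∸ 1) * (k * (k ∸ 1))                 ≡⟨ cong₂ _*_ k[k∸1]≡Σ′ k[k∸1]≡Σ′ ⟩
    Σ′ * Σ′                                     ≤⟨ cauchy-schwarz nonzero-diffs ⟩
    p * E′                                      ≤⟨ *-monoˡ-≤ E′ (n≤1+n p) ⟩
    n * E′                                      ≤⟨ *-monoʳ-≤ n (+-cancelˡ-≤ (k * k) _ _ k*k+E′≤) ⟩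
    n * (h * (k * k) + (h + suc torsion₂) * k)  ≤⟨ *-monoʳ-≤ n (+-monoʳ-≤ (h * (k * k))
                                                     (*-monoˡ-≤ k (+-monoʳ-≤ h (s≤s τ≤w)))) ⟩
    n * (h * (k * k) + (h + suc w) * k)         ∎
    where
    open ≤-Reasoning
    nonzero-diffs : Fin p → ℕ
    nonzero-diffs = removeAt diffs ε
    Σ′ E′ : ℕ
    Σ′ = sum nonzero-diffs
    E′ = ∑[ i < p ] (nonzero-diffs i * nonzero-diffs i)
    k[k∸1]≡Σ′ : k * (k ∸ 1) ≡ Σ′
    k[k∸1]≡Σ′ = begin-equality
      k * (k ∸ 1)    ≡⟨ *-distribˡ-∸ k k 1 ⟩
      k * k ∸ k * 1  ≡⟨ cong₂ _∸_ (trans (sym ∑-diffs) (trans (sum-remove diffs) (cong (_+ Σ′) diffs-ε)))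
                                  (*-identityʳ k) ⟩
      k + Σ′ ∸ k     ≡⟨ m+n∸m≡n k Σ′ ⟩
      Σ′             ∎
    k*k+E′≤ : k * k + E′ ≤ k * k + (h * (k * k) + (h + suc torsion₂) * k)
    k*k+E′≤ = begin
      k * k + E′                                      ≡⟨ cong (_+ E′) (cong₂ _*_ (sym diffs-ε) (sym diffs-ε)) ⟩
      diffs ε * diffs ε + E′                          ≡⟨ sum-remove (λ d → diffs d * diffs d) ⟨
      energy                                          ≤⟨ energy-≤ (suc h) sidon ⟩
      suc h * (k * k) + (suc h + torsion₂) * k        ≡⟨ +-assoc (k * k) (h * (k * k)) _ ⟩
      k * k + (h * (k * k) + (suc h + torsion₂) * k)  ≡⟨ cong (λ x → k * k + (h * (k * k) + x * k)) (+-suc h torsion₂) ⟨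
      k * k + (h * (k * k) + (h + suc torsion₂) * k)  ∎

module Cyclic (p : ℕ) where

  private
    n : ℕ
    n = suc p

  infixl 6 _⊕_
  _⊕_ : Op₂ (Fin n)
  a ⊕ b = (toℕ a + toℕ b) mod n

  ⊖_ : Op₁ (Fin n)
  ⊖ a = (n ∸ toℕ a) mod n

  toℕ-⊕ : ∀ a b → toℕ (a ⊕ b) ≡ (toℕ a + toℕ b) % n
  toℕ-⊕ a b = toℕ-fromℕ< _

  [m%n+o]%n≡[m+o]%n : ∀ m o → (m % n + o) % n ≡ (m + o) % n
  [m%n+o]%n≡[m+o]%n m o = begin
    (m % n + o) % n           ≡⟨ %-distribˡ-+ (m % n) o n ⟩
    (m % n % n + o % n) % n   ≡⟨ cong (λ x → (x + o % n) % n) (m%n%n≡m%n m n) ⟩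
    (m % n + o % n) % n       ≡⟨ %-distribˡ-+ m o n ⟨
    (m + o) % n               ∎
    where open ≡-Reasoning

  ⊕-comm : ∀ a b → a ⊕ b ≡ b ⊕ a
  ⊕-comm a b = cong (_mod n) (+-comm (toℕ a) (toℕ b))

  toℕ-⊕⊕ : ∀ a b c → toℕ ((a ⊕ b) ⊕ c) ≡ (toℕ a + toℕ b + toℕ c) % n
  toℕ-⊕⊕ a b c = begin
    toℕ ((a ⊕ b) ⊕ c)                    ≡⟨ toℕ-⊕ (a ⊕ b) c ⟩
    (toℕ (a ⊕ b) + toℕ c) % n            ≡⟨ cong (λ x → (x + toℕ c) % n) (toℕ-⊕ a b) ⟩
    ((toℕ a + toℕ b) % n + toℕ c) % n    ≡⟨ [m%n+o]%n≡[m+o]%n (toℕ a + toℕ b) (toℕ c) ⟩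
    (toℕ a + toℕ b + toℕ c) % n          ∎
    where open ≡-Reasoning

  ⊕-assoc : ∀ a b c → (a ⊕ b) ⊕ c ≡ a ⊕ (b ⊕ c)
  ⊕-assoc a b c = trans (toℕ-injective (begin
    toℕ ((a ⊕ b) ⊕ c)              ≡⟨ toℕ-⊕⊕ a b c ⟩
    (toℕ a + toℕ b + toℕ c) % n    ≡⟨ cong (_% n) (rotate (toℕ a) (toℕ b) (toℕ c)) ⟩
    (toℕ b + toℕ c + toℕ a) % n    ≡⟨ toℕ-⊕⊕ b c a ⟨
    toℕ ((b ⊕ c) ⊕ a)              ∎)) (⊕-comm (b ⊕ c) a)
    where
    open ≡-Reasoning
    rotate : ∀ x y z → x + y + z ≡ y + z + x
    rotate = solve-∀

  ⊕-identityʳ : ∀ a → a ⊕ zero ≡ a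
  ⊕-identityʳ a = toℕ-injective (begin
    toℕ (a ⊕ zero)       ≡⟨ toℕ-⊕ a zero ⟩
    (toℕ a + 0) % n      ≡⟨ cong (_% n) (+-identityʳ (toℕ a)) ⟩
    toℕ a % n            ≡⟨ m<n⇒m%n≡m (toℕ<n a) ⟩
    toℕ a                ∎)
    where open ≡-Reasoning

  ⊕-inverseʳ : ∀ a → a ⊕ ⊖ a ≡ zero
  ⊕-inverseʳ a = toℕ-injective (begin
    toℕ (a ⊕ ⊖ a)                  ≡⟨ toℕ-⊕ a (⊖ a) ⟩
    (toℕ a + toℕ (⊖ a)) % n        ≡⟨ cong (λ x → (toℕ a + x) % n) (toℕ-fromℕ< _) ⟩
    (toℕ a + (n ∸ toℕ a) % n) % n  ≡⟨ cong (_% n) (+-comm (toℕ a) _) ⟩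
    ((n ∸ toℕ a) % n + toℕ a) % n  ≡⟨ [m%n+o]%n≡[m+o]%n (n ∸ toℕ a) (toℕ a) ⟩
    (n ∸ toℕ a + toℕ a) % n        ≡⟨ cong (_% n) (m∸n+n≡m (<⇒≤ (toℕ<n a))) ⟩
    n % n                          ≡⟨ n%n≡0 n ⟩
    0                              ∎)
    where open ≡-Reasoning

  ⊕-isAbelianGroup : IsAbelianGroup _≡_ _⊕_ zero ⊖_
  ⊕-isAbelianGroup = record
    { isGroup = record
      { isMonoid = record
        { isSemigroup = record
          { isMagma = record { isEquivalence = isEquivalence ; ∙-cong = cong₂ _⊕_ }
          ; assoc = ⊕-assoc
          }
        ; identity = comm∧idʳ⇒id ⊕-comm ⊕-identityʳ
        }
      ; inverse = comm∧invʳ⇒inv ⊕-comm ⊕-inverseʳ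
      ; ⁻¹-cong = cong ⊖_
      }
    ; comm = ⊕-comm
    }

  t⊕t≡0⇒t≡0⊎n≡t*2 : ∀ t → t ⊕ t ≡ zero → t ≡ zero ⊎ n ≡ toℕ t * 2
  t⊕t≡0⇒t≡0⊎n≡t*2 t t⊕t≡0 with m%n≡0⇒n∣m (toℕ t + toℕ t) n (trans (sym (toℕ-⊕ t t)) (cong toℕ t⊕t≡0))
  ... | divides zero          2t≡0  = inj₁ (toℕ-injective (m+n≡0⇒m≡0 (toℕ t) 2t≡0))
  ... | divides (suc zero)    2t≡n  = inj₂ (trans (sym (+-identityʳ n)) (trans (sym 2t≡n) (m+m≡m*2 (toℕ t))))
    where
    m+m≡m*2 : ∀ m → m + m ≡ m * 2
    m+m≡m*2 = solve-∀
  ... | divides (suc (suc j)) 2t≡jn = contradiction (≤-trans (+-monoʳ-≤ n (m≤m+n n (j * n))) (≤-reflexive (sym 2t≡jn)))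
                                                    (<⇒≱ (+-mono-< (toℕ<n t) (toℕ<n t)))

  torsion₂-≤-1 : ¬ 2 ∣ n → ∑[ t < n ] 𝟙 (t ⊕ t ≟ zero) ≤ 1
  torsion₂-≤-1 odd = begin
    ∑[ t < n ] 𝟙 (t ⊕ t ≟ zero)  ≤⟨ ∑-mono-≤ (λ t → 𝟙-mono (only-zero t) (t ⊕ t ≟ zero) (t ≟ zero)) ⟩
    ∑[ t < n ] 𝟙 (t ≟ zero)      ≡⟨ ∑-𝟙-≟ {n = n} zero ⟩
    1                            ∎
    where
    open ≤-Reasoning
    only-zero : ∀ t → t ⊕ t ≡ zero → t ≡ zero
    only-zero t t⊕t≡0 with t⊕t≡0⇒t≡0⊎n≡t*2 t t⊕t≡0
    ... | inj₁ t≡0   = t≡0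
    ... | inj₂ n≡t*2 = contradiction (divides (toℕ t) n≡t*2) odd

  torsion₂-≤-2 : 2 ∣ n → ∑[ t < n ] 𝟙 (t ⊕ t ≟ zero) ≤ 2
  torsion₂-≤-2 (divides (suc j) n≡j*2) = begin
    ∑[ t < n ] 𝟙 (t ⊕ t ≟ zero)
      ≤⟨ ∑-mono-≤ (λ t → 𝟙-mono-⊎ (zero-or-half t) (t ⊕ t ≟ zero) (t ≟ zero) (t ≟ half)) ⟩
    ∑[ t < n ] (𝟙 (t ≟ zero) + 𝟙 (t ≟ half))
      ≡⟨ ∑-distrib-+ (λ t → 𝟙 (t ≟ zero)) (λ t → 𝟙 (t ≟ half)) ⟩
    ∑[ t < n ] 𝟙 (t ≟ zero) + ∑[ t < n ] 𝟙 (t ≟ half)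
      ≡⟨ cong₂ _+_ (∑-𝟙-≟ {n = n} zero) (∑-𝟙-≟ half) ⟩
    2 ∎
    where
    open ≤-Reasoning
    half<n : suc j < n
    half<n = subst (suc j <_) (sym n≡j*2) (m<m*n (suc j) 2 (s≤s (s≤s z≤n)))
    half : Fin n
    half = fromℕ< half<n
    zero-or-half : ∀ t → t ⊕ t ≡ zero → t ≡ zero ⊎ t ≡ half
    zero-or-half t t⊕t≡0 with t⊕t≡0⇒t≡0⊎n≡t*2 t t⊕t≡0
    ... | inj₁ t≡0   = inj₁ t≡0
    ... | inj₂ n≡t*2 = inj₂ (toℕ-injective (trans (*-cancelʳ-≡ (toℕ t) (suc j) 2 (trans (sym n≡t*2) n≡j*2))
                                                 (sym (toℕ-fromℕ< half<n))))

  r′≡reps≠ : ∀ (A : Subset n) x → r′ n A x ≡ AdditiveEnergy.reps≠ ⊕-isAbelianGroup A x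
  r′≡reps≠ A x = trans (length-filter-cartesianProduct (RPair? n A x) id id)
                       (sum-cong-≗ (λ a → sum-cong-≗ (λ b → 𝟙-RPair a b)))
    where
    𝟙-RPair : ∀ a b → 𝟙 (RPair? n A x (a , b)) ≡ (𝟙 (a ∈? A) * 𝟙 (b ∈? A)) * (𝟙 (¬? (a ≟ b)) * 𝟙 (a ⊕ b ≟ x))
    𝟙-RPair a b = trans (𝟙-× ((a ∈? A) ×-dec (b ∈? A)) (¬? (a ≟ b) ×-dec sum?))
                        (cong₂ _*_ (𝟙-× (a ∈? A) (b ∈? A))
                                   (trans (𝟙-× (¬? (a ≟ b)) sum?)
                                          (cong (𝟙 (¬? (a ≟ b)) *_) (𝟙-cong +q-sound +q-complete sum? (a ⊕ b ≟ x)))))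
      where
      sum? : Dec (a +q b ≡ toℕ x)
      sum? = a +q b ℕₚ.≟ toℕ x
      +q-sound : a +q b ≡ toℕ x → a ⊕ b ≡ x
      +q-sound eq = toℕ-injective (trans (toℕ-⊕ a b) eq)
      +q-complete : a ⊕ b ≡ x → a +q b ≡ toℕ x
      +q-complete eq = trans (sym (toℕ-⊕ a b)) (cong toℕ eq)

corollary2 : (g q : ℕ) .{{_ : NonZero q}} → 2 ≤ g → (A : Subset q) → WeakSidon q g A →
    ((2 ∣ q) → ((g ∸ 1) * ∣ A ∣ ∸ (2 * (g ∸ 1) + 3)) ^ 2 ≤ (g ∸ 1) ^ 3 * q)
    × ((¬ (2 ∣ q)) → (2 * (g ∸ 1) * ∣ A ∣ ∸ (3 * (g ∸ 1) + 2)) ^ 2 ≤ 4 * (g ∸ 1) ^ 3 * q)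
corollary2 (suc h) (suc p) (s≤s _) A weakSidon rewrite ∣p∣≡∑𝟙∈ A =
    (λ 2∣q → even-bound h (suc p) k (quartic-bound h 2 sidon (torsion₂-≤-2 2∣q)))
  , (λ 2∤q → odd-bound h (suc p) k (quartic-bound h 1 sidon (torsion₂-≤-1 2∤q)))
  where
  open Cyclic p
  open AdditiveEnergy ⊕-isAbelianGroup A
  sidon : ∀ x → reps≠ x ≤ suc h
  sidon x = subst (_≤ suc h) (r′≡reps≠ A x) (weakSidon x)
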